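{- For every $\ell\ge1$, the column vector $B_\ell$ equals the vector whose first entry is $0^\ell$ followed by the entries of $\mathrm{mirror}\big(\overleftarrow{A_\ell[1{:}]}\big)$.
   Context: For a word $w=w[1]\cdots w[m]$ let $\mathrm{mirror}(w)=w[m]\cdots w[1]$. For a column vector (finite sequence) of words $X=(w_1,\dots,w_p)$, let $\mathrm{mirror}(X)=(\mathrm{mirror}(w_1),\dots,\mathrm{mirror}(w_p))$, $\overleftarrow{X}=(w_p,\dots,w_1)$, $X[1{:}]=(w_2,\dots,w_p)$, and for a word $u$ let $Xu=(w_1u,\dots,w_pu)$ and $uX=(uw_1,\dots,uw_p)$. Define inductively $A_1=B_1=(0,1)$ and, for $\ell\ge1$, $A_{\ell+1}$ = the concatenation of the sequences $(0^{\ell+1})$, $A_\ell 1$, and $\overleftarrow{A_\ell[1{:}]}\,0$; $B_{\ell+1}$ = the concatenation of the sequences $(0^{\ell+1})$, $0\,\overleftarrow{B_\ell[1{:}]}$, $1\,B_\ell[1{:}]$, and $(10^\ell)$. -}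

module Defs where

open import Data.Nat using (ℕ; zero; suc)
open import Data.List using (List; []; _∷_; _++_; map; reverse; drop; replicate)

data Letter : Set where
  𝟎 𝟏 : Letter

Word : Set
Word = List Letter

Column : Set
Column = List Word

mirror : Word → Word
mirror = reverse

mirrorCol : Column → Column
mirrorCol = map mirror

rev : Column → Column
rev = reverse

tail1 : Column → Column
tail1 = drop 1

appendW : Column → Word → Column
appendW X u = map (λ w → w ++ u) X

prependW : Word → Column → Column
prependW u X = map (λ w → u ++ w) X

-- The sequences A_ℓ and B_ℓ, for ℓ ≥ 1 (index 0 is an unused dummy value []).
A : ℕ → Column
A zero = []
A (suc zero) = (𝟎 ∷ []) ∷ (𝟏 ∷ []) ∷ []
A (suc (suc ℓ)) =
  (replicate (suc (suc ℓ)) 𝟎 ∷ [])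
  ++ appendW (A (suc ℓ)) (𝟏 ∷ [])
  ++ appendW (rev (tail1 (A (suc ℓ)))) (𝟎 ∷ [])

B : ℕ → Column
B zero = []
B (suc zero) = (𝟎 ∷ []) ∷ (𝟏 ∷ []) ∷ []
B (suc (suc ℓ)) =
  (replicate (suc (suc ℓ)) 𝟎 ∷ [])
  ++ prependW (𝟎 ∷ []) (rev (tail1 (B (suc ℓ))))
  ++ prependW (𝟏 ∷ []) (tail1 (B (suc ℓ)))
  ++ ((𝟏 ∷ replicate (suc ℓ) 𝟎) ∷ [])

{-# OPTIONS --safe #-}
module Submission where

-- Both sides begin with 0^ℓ, so it suffices that Tℓ = mirror(rev(Aℓ[1:])) obeys the recurrence
-- defining the tails of B:  B(ℓ+1)[1:] = 0·rev(Bℓ[1:]) ++ 1·Bℓ[1:] ++ (10^ℓ).  Since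
-- A(ℓ+1)[1:] = Aℓ1 ++ rev(Aℓ[1:])0 and Aℓ = (0^ℓ) ++ Aℓ[1:], reversing the column and mirroring
-- every word turns the appended letters into prepended ones and yields
-- 0·rev(Tℓ) ++ 1·Tℓ ++ (1·mirror(0^ℓ)), where 0^ℓ is a palindrome.

open import Defs
open import Data.Nat using (ℕ; _≤_; zero; suc)
open import Data.List using ([]; _∷_; _++_; _∷ʳ_; map; reverse; replicate)
open import Data.List.Properties
  using (map-++; map-cong; map-∘; reverse-++; reverse-map; unfold-reverse)
open import Function using (_∘′_)
open import Relation.Binary.PropositionalEquality using (_≡_; refl; sym; trans; cong; cong₂; module ≡-Reasoning)

replicate-∷ʳ : ∀ {a} {X : Set a} n (x : X) → replicate n x ∷ʳ x ≡ x ∷ replicate n x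
replicate-∷ʳ zero    x = refl
replicate-∷ʳ (suc n) x = cong (x ∷_) (replicate-∷ʳ n x)

reverse-replicate : ∀ {a} {X : Set a} n (x : X) → reverse (replicate n x) ≡ replicate n x
reverse-replicate zero    x = refl
reverse-replicate (suc n) x = begin
  reverse (x ∷ replicate n x)   ≡⟨ unfold-reverse x (replicate n x) ⟩
  reverse (replicate n x) ∷ʳ x  ≡⟨ cong (_∷ʳ x) (reverse-replicate n x) ⟩
  replicate n x ∷ʳ x            ≡⟨ replicate-∷ʳ n x ⟩
  x ∷ replicate n x             ∎
  where open ≡-Reasoning

mirrorRev : Column → Column
mirrorRev X = mirrorCol (rev X)

mirrorRev-++ : ∀ X Y → mirrorRev (X ++ Y) ≡ mirrorRev Y ++ mirrorRev X
mirrorRev-++ X Y = trans (cong mirrorCol (reverse-++ X Y)) (map-++ mirror (rev Y) (rev X))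

mirrorRev-∷ : ∀ w X → mirrorRev (w ∷ X) ≡ mirrorRev X ++ mirror w ∷ []
mirrorRev-∷ w X = mirrorRev-++ (w ∷ []) X

mirrorRev-rev : ∀ X → mirrorRev (rev X) ≡ rev (mirrorRev X)
mirrorRev-rev X = reverse-map mirror (rev X)

mirrorCol-appendW : ∀ X u → mirrorCol (appendW X u) ≡ prependW (mirror u) (mirrorCol X)
mirrorCol-appendW X u = begin
  map mirror (map (_++ u) X)       ≡⟨ map-∘ X ⟨
  map (mirror ∘′ (_++ u)) X        ≡⟨ map-cong (λ w → reverse-++ w u) X ⟩
  map ((mirror u ++_) ∘′ mirror) X ≡⟨ map-∘ X ⟩
  prependW (mirror u) (mirrorCol X) ∎
  where open ≡-Reasoning

mirrorRev-appendW : ∀ X u → mirrorRev (appendW X u) ≡ prependW (mirror u) (mirrorRev X)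
mirrorRev-appendW X u = begin
  mirrorCol (rev (appendW X u))  ≡⟨ cong mirrorCol (reverse-map (_++ u) X) ⟨
  mirrorCol (appendW (rev X) u)  ≡⟨ mirrorCol-appendW (rev X) u ⟩
  prependW (mirror u) (mirrorRev X) ∎
  where open ≡-Reasoning

reflect : Word → Column → Column
reflect z X = prependW (𝟎 ∷ []) (rev X) ++ prependW (𝟏 ∷ []) X ++ (𝟏 ∷ z) ∷ []

mirrorRev-reflect : ∀ z T →
  mirrorRev (appendW (z ∷ T) (𝟏 ∷ []) ++ appendW (rev T) (𝟎 ∷ [])) ≡ reflect (mirror z) (mirrorRev T)
mirrorRev-reflect z T = begin
  mirrorRev (appendW (z ∷ T) (𝟏 ∷ []) ++ appendW (rev T) (𝟎 ∷ []))
    ≡⟨ mirrorRev-++ (appendW (z ∷ T) (𝟏 ∷ [])) (appendW (rev T) (𝟎 ∷ [])) ⟩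
  mirrorRev (appendW (rev T) (𝟎 ∷ [])) ++ mirrorRev (appendW (z ∷ T) (𝟏 ∷ []))
    ≡⟨ cong₂ _++_ (mirrorRev-appendW (rev T) (𝟎 ∷ [])) (mirrorRev-appendW (z ∷ T) (𝟏 ∷ [])) ⟩
  prependW (𝟎 ∷ []) (mirrorRev (rev T)) ++ prependW (𝟏 ∷ []) (mirrorRev (z ∷ T))
    ≡⟨ cong₂ (λ X Y → prependW (𝟎 ∷ []) X ++ prependW (𝟏 ∷ []) Y) (mirrorRev-rev T) (mirrorRev-∷ z T) ⟩
  prependW (𝟎 ∷ []) (rev (mirrorRev T)) ++ prependW (𝟏 ∷ []) (mirrorRev T ++ mirror z ∷ [])
    ≡⟨ cong (prependW (𝟎 ∷ []) (rev (mirrorRev T)) ++_) (map-++ (𝟏 ∷_) (mirrorRev T) (mirror z ∷ [])) ⟩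
  reflect (mirror z) (mirrorRev T) ∎
  where open ≡-Reasoning

A-head : ∀ n → A (suc n) ≡ replicate (suc n) 𝟎 ∷ tail1 (A (suc n))
A-head zero    = refl
A-head (suc n) = refl

B-head : ∀ n → B (suc n) ≡ replicate (suc n) 𝟎 ∷ tail1 (B (suc n))
B-head zero    = refl
B-head (suc n) = refl

mirrorRev-tail-A-suc : ∀ n →
  mirrorRev (tail1 (A (suc (suc n)))) ≡ reflect (replicate (suc n) 𝟎) (mirrorRev (tail1 (A (suc n))))
mirrorRev-tail-A-suc n = begin
  mirrorRev (appendW (A (suc n)) (𝟏 ∷ []) ++ appendW (rev T) (𝟎 ∷ []))
    ≡⟨ cong (λ X → mirrorRev (appendW X (𝟏 ∷ []) ++ appendW (rev T) (𝟎 ∷ []))) (A-head n) ⟩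
  mirrorRev (appendW (z ∷ T) (𝟏 ∷ []) ++ appendW (rev T) (𝟎 ∷ []))
    ≡⟨ mirrorRev-reflect z T ⟩
  reflect (mirror z) (mirrorRev T)
    ≡⟨ cong (λ w → reflect w (mirrorRev T)) (reverse-replicate (suc n) 𝟎) ⟩
  reflect z (mirrorRev T) ∎
  where
  open ≡-Reasoning
  z : Word
  z = replicate (suc n) 𝟎
  T : Column
  T = tail1 (A (suc n))

tail-B≡mirrorRev-tail-A : ∀ n → tail1 (B (suc n)) ≡ mirrorRev (tail1 (A (suc n)))
tail-B≡mirrorRev-tail-A zero    = refl
tail-B≡mirrorRev-tail-A (suc n) =
  trans (cong (reflect (replicate (suc n) 𝟎)) (tail-B≡mirrorRev-tail-A n)) (sym (mirrorRev-tail-A-suc n))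

lemma20 : (ℓ : ℕ) → 1 ≤ ℓ →
    B ℓ ≡ replicate ℓ 𝟎 ∷ mirrorCol (rev (tail1 (A ℓ)))
lemma20 (suc n) _ = trans (B-head n) (cong (replicate (suc n) 𝟎 ∷_) (tail-B≡mirrorRev-tail-A n))
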